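{- Let $k\geq 2$ be an integer and, for $n\geq 0$, let $f_{k,n}$ denote the number of cyclic even-up words over $k$ of length $n$. Let $F_k(x)=\sum_{n\geq 0}f_{k,n}x^n$. Then \[F_k(x)=1+x\left(\left\lfloor \frac{k}{2}\right\rfloor-\left\lfloor\frac{k+1}{2}\right\rfloor\frac{(x+1)^{\lfloor (k-1)/2\rfloor}}{(x+1)^{\lfloor (k+1)/2\rfloor}-2}\right).\]
   Context: For an integer $k\geq 2$, let $[k]=\{1,\ldots,k\}$. A word over $k$ of length $n$ is an element $w_1\cdots w_n\in[k]^n$. A word $w_1\cdots w_n$ with $n\geq 2$ is cyclic even-up if for every $i\in[n]$, whenever $w_i$ is even, $w_{i+1}>w_i$, where $w_{n+1}$ is defined to be $w_1$. By convention, the empty word (length $0$) and every word of length $1$ (i.e., each of the $k$ single letters) are counted as cyclic even-up. -}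

module Defs where

open import Data.Nat using (ℕ; zero; suc; _<_; _<?_; _∸_)
open import Data.Nat.Divisibility using (_∣_; _∣?_)
open import Data.Nat.DivMod using (_/_)
open import Data.Nat.Combinatorics using (_C_)
open import Data.Fin using (Fin; toℕ; zero; suc; fromℕ; inject₁)
open import Data.Fin.Properties using (all?)
open import Data.Vec using (Vec; []; _∷_; lookup)
open import Data.List using (List; []; _∷_; map; concatMap; allFin; filter; length; sum; upTo)
open import Data.Unit using (⊤; tt)
open import Data.Integer as ℤ using (ℤ; +_)
open import Relation.Nullary using (Dec; yes; _→-dec_)

-- A word over k of length n: w : Vec (Fin k) n, letter i ∈ Fin k stands for toℕ i + 1 ∈ [k].
letter : {k : ℕ} → Fin k → ℕ
letter i = suc (toℕ i)

cnext : {m : ℕ} → Fin (suc m) → Fin (suc m)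
cnext {zero} zero = zero
cnext {suc m} zero = suc zero
cnext {suc m} (suc i) with cnext {m} i
... | zero = zero
... | suc j = suc (suc j)

-- Cyclic even-up (for length ≥ 2): whenever w_i is even, w_{i+1} > w_i (indices cyclic).
-- Lengths 0 and 1 are cyclic even-up by convention.
CyclicEvenUp : {k n : ℕ} → Vec (Fin k) n → Set
CyclicEvenUp {k} {zero} w = ⊤
CyclicEvenUp {k} {suc zero} w = ⊤
CyclicEvenUp {k} {suc (suc m)} w =
  (i : Fin (suc (suc m))) → 2 ∣ letter (lookup w i) → letter (lookup w i) < letter (lookup w (cnext i))

cyclicEvenUp? : {k n : ℕ} (w : Vec (Fin k) n) → Dec (CyclicEvenUp w)
cyclicEvenUp? {k} {zero} w = yes tt
cyclicEvenUp? {k} {suc zero} w = yes tt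
cyclicEvenUp? {k} {suc (suc m)} w =
  all? (λ i → (2 ∣? letter (lookup w i)) →-dec (letter (lookup w i) <? letter (lookup w (cnext i))))

allWords : (k n : ℕ) → List (Vec (Fin k) n)
allWords k zero = [] ∷ []
allWords k (suc n) = concatMap (λ w → map (_∷ w) (allFin k)) (allWords k n)

f : (k n : ℕ) → ℕ
f k n = length (filter cyclicEvenUp? (allWords k n))

Series : Set
Series = ℕ → ℤ

const : ℤ → Series
const c zero = c
const c (suc _) = + 0

X : Series
X 1 = + 1
X _ = + 0

_⊕_ : Series → Series → Series
(A ⊕ B) n = A n ℤ.+ B n

_⊖_ : Series → Series → Series
(A ⊖ B) n = A n ℤ.- B n

_⊛_ : Series → Series → Series
(A ⊛ B) n = Data.List.foldr ℤ._+_ (+ 0) (map (λ i → A i ℤ.* B (n ∸ i)) (upTo (suc n)))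

_^ₛ_ : Series → ℕ → Series
A ^ₛ zero = const (+ 1)
A ^ₛ suc m = A ⊛ (A ^ₛ m)

infixl 6 _⊕_ _⊖_
infixl 7 _⊛_
infixr 8 _^ₛ_

F : ℕ → Series
F k n = + f k n

-- Put the letter k ∸ r at position r < k. A word is cyclic even-up iff every cyclically
-- consecutive pair of letters is allowed by the 0/1 matrix T with
-- T r s = [k ∸ r odd] + [k ∸ r even]·[s < r], so f_{k,n} = tr Tⁿ for n ≥ 2. Now T = N + u 1ᵀ
-- is a rank-one update of the nilpotent N r s = [k ∸ r even]·[s < r], u marking the odd
-- letters, and expanding Tⁿ along this decomposition yields Newton's identity
-- tr T^(n+1) = (n+1) β_n + Σ_{i+j=n} β_i tr T^j (reading tr T⁰ as 0) with β_j = 1ᵀ Nʲ u.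
-- β_j counts j increasing even letters followed by a larger odd letter, so β_j = C(⌈k/2⌉, j+1).
-- In generating functions, τ(x) = Σ_{n≥1} tr Tⁿ xⁿ satisfies
-- τ(x) ((1+x)^⌈k/2⌉ − 2) = −⌈k/2⌉ x (1+x)^(⌈k/2⌉−1), and F_k = 1 + ⌊k/2⌋ x + τ(x)
-- because f_{k,1} = k = ⌊k/2⌋ + tr T.
module Submission where

open import Data.Empty using (⊥-elim)
open import Data.Fin using (Fin; zero; suc; toℕ)
open import Data.Fin.Properties using (toℕ<n)
import Data.Integer as ℤ
import Data.Integer.Properties as ℤ
import Data.Integer.Tactic.RingSolver as ℤ-Solver
open import Data.List using (List; []; _∷_; _++_; map; concatMap; filter; length; tabulate; allFin; foldr; applyUpTo; upTo)
open import Data.List.Properties using (map-tabulate; map-cong; filter-all; ++-identityʳ; length-map; length-tabulate)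
open import Data.List.Relation.Unary.All using (universal)
open import Data.Nat using (ℕ; zero; suc; _+_; _*_; _∸_; _≤_; _<_; z≤n; s≤s; z<s; _≟_; _<?_; ⌊_/2⌋; ⌈_/2⌉)
open import Data.Nat.Combinatorics using (_C_; nC1≡n; nCk+nC[k+1]≡[n+1]C[k+1]; k>n⇒nCk≡0)
open import Data.Nat.Divisibility using (_∣_; _∣?_; divides)
open import Data.Nat.DivMod using (_/_; m/n≡1+[m∸n]/n)
open import Data.Nat.Properties
open import Data.Nat.Tactic.RingSolver using (solve-∀)
open import Data.Product using (_×_; _,_)
open import Data.Sum using (_⊎_; inj₁; inj₂)
open import Data.Unit using (tt)
open import Data.Vec using (Vec; []; _∷_; lookup; _∷ʳ_)
open import Function using (_∘_; id; _⇔_; mk⇔; Equivalence)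
open import Function.Endo.Propositional (ℕ → ℕ) using (_^_; ^-homo)
open import Relation.Binary using (Decidable)
open import Relation.Binary.PropositionalEquality
open import Relation.Nullary using (Dec; yes; no; ¬_; _×-dec_; _→-dec_)
open import Algebra.Properties.CommutativeSemigroup +-commutativeSemigroup using (interchange; x∙yz≈y∙xz)
open import Algebra.Properties.CommutativeSemigroup ℤ.+-commutativeSemigroup
  using () renaming (interchange to ℤ-interchange)

open import Defs
  using (cnext; letter; CyclicEvenUp; cyclicEvenUp?; allWords; f; F; Series; const; X; _⊕_; _⊖_; _⊛_; _^ₛ_)

𝟙 : ∀ {p} {P : Set p} → Dec P → ℕ
𝟙 (yes _) = 1
𝟙 (no _)  = 0

𝟙-yes : ∀ {p} {P : Set p} (P? : Dec P) → P → 𝟙 P? ≡ 1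
𝟙-yes (yes _) _  = refl
𝟙-yes (no ¬p) p  = ⊥-elim (¬p p)

𝟙-no : ∀ {p} {P : Set p} (P? : Dec P) → ¬ P → 𝟙 P? ≡ 0
𝟙-no (yes p) ¬p = ⊥-elim (¬p p)
𝟙-no (no _)  _  = refl

𝟙-cong : ∀ {p q} {P : Set p} {Q : Set q} (P? : Dec P) (Q? : Dec Q) → P ⇔ Q → 𝟙 P? ≡ 𝟙 Q?
𝟙-cong (yes p) Q? P⇔Q = sym (𝟙-yes Q? (Equivalence.to P⇔Q p))
𝟙-cong (no ¬p) Q? P⇔Q = sym (𝟙-no Q? (¬p ∘ Equivalence.from P⇔Q))

𝟙-× : ∀ {p q} {P : Set p} {Q : Set q} (P? : Dec P) (Q? : Dec Q) → 𝟙 (P? ×-dec Q?) ≡ 𝟙 P? * 𝟙 Q?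
𝟙-× (yes _) (yes _) = refl
𝟙-× (yes _) (no _)  = refl
𝟙-× (no _)  _       = refl

∑ : ℕ → (ℕ → ℕ) → ℕ
∑ zero    g = 0
∑ (suc n) g = ∑ n g + g n

∑-cong-< : ∀ n {g h : ℕ → ℕ} → (∀ {i} → i < n → g i ≡ h i) → ∑ n g ≡ ∑ n h
∑-cong-< zero    eq = refl
∑-cong-< (suc n) eq = cong₂ _+_ (∑-cong-< n (λ i<n → eq (m<n⇒m<1+n i<n))) (eq (n<1+n n))

∑-cong : ∀ n {g h : ℕ → ℕ} → g ≗ h → ∑ n g ≡ ∑ n h
∑-cong n eq = ∑-cong-< n (λ {i} _ → eq i)

∑-zero : ∀ n → ∑ n (λ _ → 0) ≡ 0
∑-zero zero    = refl
∑-zero (suc n) = trans (+-identityʳ _) (∑-zero n)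

∑-vanishes : ∀ n {g : ℕ → ℕ} → (∀ {i} → i < n → g i ≡ 0) → ∑ n g ≡ 0
∑-vanishes n eq = trans (∑-cong-< n eq) (∑-zero n)

∑-+ : ∀ n (g h : ℕ → ℕ) → ∑ n (λ i → g i + h i) ≡ ∑ n g + ∑ n h
∑-+ zero    g h = refl
∑-+ (suc n) g h = trans (cong (_+ (g n + h n)) (∑-+ n g h)) (interchange (∑ n g) (∑ n h) (g n) (h n))

∑-*ˡ : ∀ n c (g : ℕ → ℕ) → ∑ n (λ i → c * g i) ≡ c * ∑ n g
∑-*ˡ zero    c g = sym (*-zeroʳ c)
∑-*ˡ (suc n) c g = trans (cong (_+ c * g n) (∑-*ˡ n c g)) (sym (*-distribˡ-+ c (∑ n g) (g n)))

∑-*ʳ : ∀ n c (g : ℕ → ℕ) → ∑ n (λ i → g i * c) ≡ ∑ n g * c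
∑-*ʳ n c g = trans (∑-cong n (λ i → *-comm (g i) c)) (trans (∑-*ˡ n c g) (*-comm c (∑ n g)))

∑-comm : ∀ m n (g : ℕ → ℕ → ℕ) → ∑ m (λ i → ∑ n (g i)) ≡ ∑ n (λ j → ∑ m (λ i → g i j))
∑-comm zero    n g = sym (∑-zero n)
∑-comm (suc m) n g =
  trans (cong (_+ ∑ n (g m)) (∑-comm m n g)) (sym (∑-+ n (λ j → ∑ m (λ i → g i j)) (g m)))

∑-sucˡ : ∀ n (g : ℕ → ℕ) → ∑ (suc n) g ≡ g 0 + ∑ n (λ i → g (suc i))
∑-sucˡ zero    g = sym (+-identityʳ (g 0))
∑-sucˡ (suc n) g = trans (cong (_+ g (suc n)) (∑-sucˡ n g)) (+-assoc (g 0) _ _)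

∑-reverse : ∀ n (g : ℕ → ℕ) → ∑ n (λ i → g (n ∸ suc i)) ≡ ∑ n g
∑-reverse zero    g = refl
∑-reverse (suc n) g = begin
  ∑ n (λ i → g (n ∸ i)) + g (n ∸ n)
    ≡⟨ cong₂ _+_ (∑-cong-< n (λ i<n → cong g (+-∸-assoc 1 i<n))) (cong g (n∸n≡0 n)) ⟩
  ∑ n (λ i → g (suc (n ∸ suc i))) + g 0
    ≡⟨ cong (_+ g 0) (∑-reverse n (λ i → g (suc i))) ⟩
  ∑ n (λ i → g (suc i)) + g 0
    ≡⟨ +-comm _ (g 0) ⟩
  g 0 + ∑ n (λ i → g (suc i))
    ≡⟨ ∑-sucˡ n g ⟨
  ∑ (suc n) g ∎
  where open ≡-Reasoning

∑-restrict : ∀ R d (g : ℕ → ℕ) → ∑ (R + d) (λ i → 𝟙 (i <? R) * g i) ≡ ∑ R g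
∑-restrict R zero g = begin
  ∑ (R + 0) (λ i → 𝟙 (i <? R) * g i)  ≡⟨ cong (λ n → ∑ n (λ i → 𝟙 (i <? R) * g i)) (+-identityʳ R) ⟩
  ∑ R (λ i → 𝟙 (i <? R) * g i)        ≡⟨ ∑-cong-< R (λ {i} i<R → cong (_* g i) (𝟙-yes (i <? R) i<R)) ⟩
  ∑ R (λ i → 1 * g i)                 ≡⟨ ∑-cong R (λ i → *-identityˡ (g i)) ⟩
  ∑ R g                               ∎
  where open ≡-Reasoning
∑-restrict R (suc d) g = begin
  ∑ (R + suc d) (λ i → 𝟙 (i <? R) * g i)
    ≡⟨ cong (λ n → ∑ n (λ i → 𝟙 (i <? R) * g i)) (+-suc R d) ⟩
  ∑ (R + d) (λ i → 𝟙 (i <? R) * g i) + 𝟙 (R + d <? R) * g (R + d)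
    ≡⟨ cong₂ _+_ (∑-restrict R d g) (cong (_* g (R + d)) (𝟙-no (R + d <? R) (m+n≮m R d))) ⟩
  ∑ R g + 0
    ≡⟨ +-identityʳ _ ⟩
  ∑ R g ∎
  where open ≡-Reasoning

-- antidiag n G = Σ_{i+j+1=n} G i j, a sum of n terms.
antidiag : ℕ → (ℕ → ℕ → ℕ) → ℕ
antidiag zero    G = 0
antidiag (suc n) G = G 0 n + antidiag n (λ i j → G (suc i) j)

antidiag-cong : ∀ n {G H : ℕ → ℕ → ℕ} → (∀ i j → G i j ≡ H i j) → antidiag n G ≡ antidiag n H
antidiag-cong zero    eq = refl
antidiag-cong (suc n) eq = cong₂ _+_ (eq 0 n) (antidiag-cong n (λ i → eq (suc i)))

antidiag-+ : ∀ n (G H : ℕ → ℕ → ℕ) → antidiag n (λ i j → G i j + H i j) ≡ antidiag n G + antidiag n H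
antidiag-+ zero    G H = refl
antidiag-+ (suc n) G H =
  trans (cong ((G 0 n + H 0 n) +_) (antidiag-+ n _ _)) (interchange (G 0 n) (H 0 n) _ _)

antidiag-*ˡ : ∀ n c (G : ℕ → ℕ → ℕ) → antidiag n (λ i j → c * G i j) ≡ c * antidiag n G
antidiag-*ˡ zero    c G = sym (*-zeroʳ c)
antidiag-*ˡ (suc n) c G = trans (cong (c * G 0 n +_) (antidiag-*ˡ n c _)) (sym (*-distribˡ-+ c _ _))

antidiag-sucʳ : ∀ n (G : ℕ → ℕ → ℕ) → antidiag (suc n) G ≡ G n 0 + antidiag n (λ i j → G i (suc j))
antidiag-sucʳ zero    G = refl
antidiag-sucʳ (suc n) G = begin
  G 0 (suc n) + antidiag (suc n) (λ i j → G (suc i) j)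
    ≡⟨ cong (G 0 (suc n) +_) (antidiag-sucʳ n (λ i j → G (suc i) j)) ⟩
  G 0 (suc n) + (G (suc n) 0 + antidiag n (λ i j → G (suc i) (suc j)))
    ≡⟨ x∙yz≈y∙xz (G 0 (suc n)) (G (suc n) 0) _ ⟩
  G (suc n) 0 + (G 0 (suc n) + antidiag n (λ i j → G (suc i) (suc j)))
    ∎
  where open ≡-Reasoning

antidiag-comm : ∀ n (G : ℕ → ℕ → ℕ) → antidiag n G ≡ antidiag n (λ i j → G j i)
antidiag-comm zero    G = refl
antidiag-comm (suc n) G = trans (cong (G 0 n +_) (antidiag-comm n (λ i j → G (suc i) j)))
                                (sym (antidiag-sucʳ n (λ i j → G j i)))

antidiag-diagonal : ∀ n (g : ℕ → ℕ) → antidiag (suc n) (λ i j → g (j + i)) ≡ suc n * g n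
antidiag-diagonal zero    g = refl
antidiag-diagonal (suc n) g = begin
  g (suc n + 0) + antidiag (suc n) (λ i j → g (j + suc i))
    ≡⟨ cong₂ _+_ (cong g (+-identityʳ (suc n))) (antidiag-cong (suc n) (λ i j → cong g (+-suc j i))) ⟩
  g (suc n) + antidiag (suc n) (λ i j → g (suc (j + i)))
    ≡⟨ cong (g (suc n) +_) (antidiag-diagonal n (λ m → g (suc m))) ⟩
  g (suc n) + suc n * g (suc n) ∎
  where open ≡-Reasoning

antidiag-assoc : ∀ n (G : ℕ → ℕ → ℕ → ℕ) →
  antidiag n (λ j m → antidiag m (λ i p → G i j p)) ≡ antidiag n (λ i m → antidiag m (λ j p → G i j p))
antidiag-assoc zero    G = refl
antidiag-assoc (suc n) G = begin
  antidiag (suc n) (λ j m → antidiag m (λ i p → G i j p))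
    ≡⟨ antidiag-sucʳ n (λ j m → antidiag m (λ i p → G i j p)) ⟩
  antidiag n (λ j m → antidiag (suc m) (λ i p → G i j p))
    ≡⟨ antidiag-cong n (λ j m → antidiag-sucʳ m (λ i p → G i j p)) ⟩
  antidiag n (λ j m → G m j 0 + antidiag m (λ i p → G i j (suc p)))
    ≡⟨ antidiag-+ n _ _ ⟩
  antidiag n (λ j m → G m j 0) + antidiag n (λ j m → antidiag m (λ i p → G i j (suc p)))
    ≡⟨ cong₂ _+_ (antidiag-comm n (λ j m → G m j 0)) (antidiag-assoc n (λ i j p → G i j (suc p))) ⟩
  antidiag n (λ i m → G i m 0) + antidiag n (λ i m → antidiag m (λ j p → G i j (suc p)))
    ≡⟨ antidiag-+ n _ _ ⟨
  antidiag n (λ i m → G i m 0 + antidiag m (λ j p → G i j (suc p)))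
    ≡⟨ antidiag-cong n (λ i m → antidiag-sucʳ m (λ j p → G i j p)) ⟨
  antidiag n (λ i m → antidiag (suc m) (λ j p → G i j p))
    ≡⟨ antidiag-sucʳ n (λ i m → antidiag m (λ j p → G i j p)) ⟨
  antidiag (suc n) (λ i m → antidiag m (λ j p → G i j p)) ∎
  where open ≡-Reasoning

∑-antidiag : ∀ m n (G : ℕ → ℕ → ℕ → ℕ) →
  ∑ m (λ r → antidiag n (G r)) ≡ antidiag n (λ i j → ∑ m (λ r → G r i j))
∑-antidiag m zero    G = ∑-zero m
∑-antidiag m (suc n) G =
  trans (∑-+ m _ _) (cong (∑ m (λ r → G r 0 n) +_) (∑-antidiag m n (λ r i → G r (suc i))))

∑-antidiag-expansion : ∀ m n {x y : ℕ → ℕ} (a : ℕ → ℕ → ℕ) (c : ℕ → ℕ) →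
  (∀ r → x r ≡ y r + antidiag n (λ i j → a i r * c j)) →
  ∑ m x ≡ ∑ m y + antidiag n (λ i j → ∑ m (a i) * c j)
∑-antidiag-expansion m n {x} {y} a c x≡ = begin
  ∑ m x
    ≡⟨ ∑-cong m x≡ ⟩
  ∑ m (λ r → y r + antidiag n (λ i j → a i r * c j))
    ≡⟨ ∑-+ m y _ ⟩
  ∑ m y + ∑ m (λ r → antidiag n (λ i j → a i r * c j))
    ≡⟨ cong (∑ m y +_) (∑-antidiag m n (λ r i j → a i r * c j)) ⟩
  ∑ m y + antidiag n (λ i j → ∑ m (λ r → a i r * c j))
    ≡⟨ cong (∑ m y +_) (antidiag-cong n (λ i j → ∑-*ʳ m (c j) (a i))) ⟩
  ∑ m y + antidiag n (λ i j → ∑ m (a i) * c j) ∎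
  where open ≡-Reasoning

V : Set
V = ℕ → ℕ

δ : ℕ → V
δ s r = 𝟙 (s ≟ r)

∑-*δ : ∀ n (g : V) r → ∑ n (λ s → g s * δ s r) ≡ 𝟙 (r <? n) * g r
∑-*δ zero    g r = cong (_* g r) (sym (𝟙-no (r <? 0) λ ()))
∑-*δ (suc n) g r with n ≟ r
... | yes refl = begin
  ∑ n (λ s → g s * δ s n) + g n * 1    ≡⟨ cong (_+ g n * 1) (∑-*δ n g n) ⟩
  𝟙 (n <? n) * g n + g n * 1            ≡⟨ cong₂ (λ b c → b * g n + c) (𝟙-no (n <? n) (n≮n n)) (*-identityʳ (g n)) ⟩
  g n                                   ≡⟨ *-identityˡ (g n) ⟨
  1 * g n                               ≡⟨ cong (_* g n) (𝟙-yes (n <? suc n) (n<1+n n)) ⟨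
  𝟙 (n <? suc n) * g n                  ∎
  where open ≡-Reasoning
... | no n≢r = begin
  ∑ n (λ s → g s * δ s r) + g n * 0    ≡⟨ cong₂ _+_ (∑-*δ n g r) (*-zeroʳ (g n)) ⟩
  𝟙 (r <? n) * g r + 0                  ≡⟨ +-identityʳ _ ⟩
  𝟙 (r <? n) * g r                      ≡⟨ cong (_* g r) (𝟙-cong (r <? n) (r <? suc n) (mk⇔ m<n⇒m<1+n r<n)) ⟩
  𝟙 (r <? suc n) * g r                  ∎
  where
  open ≡-Reasoning
  r<n : r < suc n → r < n
  r<n r<1+n = ≤∧≢⇒< (≤-pred r<1+n) (n≢r ∘ sym)

∑-δ : ∀ n s → ∑ n (δ s) ≡ 𝟙 (s <? n)
∑-δ n s = begin
  ∑ n (δ s)                ≡⟨ ∑-cong n (λ r → trans (𝟙-cong (s ≟ r) (r ≟ s) (mk⇔ sym sym)) (sym (*-identityˡ _))) ⟩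
  ∑ n (λ r → 1 * δ r s)    ≡⟨ ∑-*δ n (λ _ → 1) s ⟩
  𝟙 (s <? n) * 1           ≡⟨ *-identityʳ _ ⟩
  𝟙 (s <? n)               ∎
  where open ≡-Reasoning

module RankOneUpdate (k : ℕ) (u d : V) where

  N : V → V
  N w r = d r * ∑ r w

  T : V → V
  T w r = u r * ∑ k w + N w r

  β : ℕ → ℕ
  β i = ∑ k ((N ^ i) u)

  γ : ℕ → ℕ → ℕ
  γ p j = ∑ k ((T ^ p) ((N ^ j) u))

  trace : ℕ → ℕ
  trace n = ∑ k (λ s → (T ^ n) (δ s) s)

  -- Equal to trace n for n ≥ 1 (trace≡τ), but τ 0 = 0 whereas trace 0 = k.
  τ : ℕ → ℕ
  τ n = antidiag n (λ j p → γ p j)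

  T^-expand : ∀ n w r → (T ^ n) w r ≡ (N ^ n) w r + antidiag n (λ i j → (N ^ i) u r * ∑ k ((T ^ j) w))
  T^-expand zero    w r = sym (+-identityʳ (w r))
  T^-expand (suc n) w r = begin
    u r * S n + d r * ∑ r ((T ^ n) w)
      ≡⟨ cong (λ z → u r * S n + d r * z) (∑-antidiag-expansion r n (λ i → (N ^ i) u) S (T^-expand n w)) ⟩
    u r * S n + d r * (∑ r ((N ^ n) w) + D)
      ≡⟨ cong (u r * S n +_) (*-distribˡ-+ (d r) _ D) ⟩
    u r * S n + ((N ^ suc n) w r + d r * D)
      ≡⟨ x∙yz≈y∙xz (u r * S n) ((N ^ suc n) w r) (d r * D) ⟩
    (N ^ suc n) w r + (u r * S n + d r * D)
      ≡⟨ cong (λ z → (N ^ suc n) w r + (u r * S n + z)) (antidiag-*ˡ n (d r) _) ⟨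
    (N ^ suc n) w r + (u r * S n + antidiag n (λ i j → d r * (∑ r ((N ^ i) u) * S j)))
      ≡⟨ cong (λ z → (N ^ suc n) w r + (u r * S n + z)) (antidiag-cong n (λ i j → *-assoc (d r) _ (S j))) ⟨
    (N ^ suc n) w r + antidiag (suc n) (λ i j → (N ^ i) u r * S j) ∎
    where
    open ≡-Reasoning
    S : ℕ → ℕ
    S j = ∑ k ((T ^ j) w)
    D : ℕ
    D = antidiag n (λ i j → ∑ r ((N ^ i) u) * S j)

  γ-recurrence : ∀ m j → γ m j ≡ β (m + j) + antidiag m (λ i q → β i * γ q j)
  γ-recurrence m j = begin
    γ m j
      ≡⟨ ∑-antidiag-expansion k m (λ i → (N ^ i) u) (λ q → γ q j) (T^-expand m ((N ^ j) u)) ⟩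
    ∑ k ((N ^ m) ((N ^ j) u)) + antidiag m (λ i q → β i * γ q j)
      ≡⟨ cong (λ M → ∑ k (M u) + antidiag m (λ i q → β i * γ q j)) (^-homo N m j) ⟨
    β (m + j) + antidiag m (λ i q → β i * γ q j) ∎
    where open ≡-Reasoning

  newton : ∀ n → τ (suc n) ≡ suc n * β n + antidiag (suc n) (λ i p → β i * τ p)
  newton n = begin
    antidiag (suc n) (λ j p → γ p j)
      ≡⟨ antidiag-cong (suc n) (λ j p → γ-recurrence p j) ⟩
    antidiag (suc n) (λ j p → β (p + j) + antidiag p (λ i q → β i * γ q j))
      ≡⟨ antidiag-+ (suc n) (λ j p → β (p + j)) (λ j p → antidiag p (λ i q → β i * γ q j)) ⟩
    antidiag (suc n) (λ j p → β (p + j)) + antidiag (suc n) (λ j p → antidiag p (λ i q → β i * γ q j))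
      ≡⟨ cong₂ _+_ (antidiag-diagonal n β) (antidiag-assoc (suc n) (λ i j q → β i * γ q j)) ⟩
    suc n * β n + antidiag (suc n) (λ i p → antidiag p (λ j q → β i * γ q j))
      ≡⟨ cong (suc n * β n +_) (antidiag-cong (suc n) (λ i p → antidiag-*ˡ p (β i) (λ j q → γ q j))) ⟩
    suc n * β n + antidiag (suc n) (λ i p → β i * τ p) ∎
    where open ≡-Reasoning

  N^-δ-below : ∀ n s {r} → r < s → (N ^ n) (δ s) r ≡ 0
  N^-δ-below zero    s r<s = 𝟙-no (s ≟ _) (>⇒≢ r<s)
  N^-δ-below (suc n) s {r} r<s =
    trans (cong (d r *_) (∑-vanishes r (λ x<r → N^-δ-below n s (<-trans x<r r<s)))) (*-zeroʳ (d r))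

  N^suc-δ-diagonal : ∀ n s → (N ^ suc n) (δ s) s ≡ 0
  N^suc-δ-diagonal n s = trans (cong (d s *_) (∑-vanishes s (N^-δ-below n s))) (*-zeroʳ (d s))

  T^-linear : ∀ p w {r} → r < k → (T ^ p) w r ≡ ∑ k (λ s → w s * (T ^ p) (δ s) r)
  T^-linear zero w {r} r<k = sym (trans (∑-*δ k w r) (trans (cong (_* w r) (𝟙-yes (r <? k) r<k)) (*-identityˡ (w r))))
  T^-linear (suc p) w {r} r<k = begin
    u r * ∑ k ((T ^ p) w) + d r * ∑ r ((T ^ p) w)
      ≡⟨ cong₂ (λ a b → u r * a + d r * b) (∑-T^ k ≤-refl) (∑-T^ r (<⇒≤ r<k)) ⟩
    u r * ∑ k (λ s → w s * ∑ k ((T ^ p) (δ s))) + d r * ∑ k (λ s → w s * ∑ r ((T ^ p) (δ s)))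
      ≡⟨ cong₂ _+_ (∑-*ˡ k (u r) _) (∑-*ˡ k (d r) _) ⟨
    ∑ k (λ s → u r * (w s * ∑ k ((T ^ p) (δ s)))) + ∑ k (λ s → d r * (w s * ∑ r ((T ^ p) (δ s))))
      ≡⟨ ∑-+ k _ _ ⟨
    ∑ k (λ s → u r * (w s * ∑ k ((T ^ p) (δ s))) + d r * (w s * ∑ r ((T ^ p) (δ s))))
      ≡⟨ ∑-cong k (λ s → distribute (w s) (u r) (∑ k ((T ^ p) (δ s))) (d r) (∑ r ((T ^ p) (δ s)))) ⟩
    ∑ k (λ s → w s * (u r * ∑ k ((T ^ p) (δ s)) + d r * ∑ r ((T ^ p) (δ s)))) ∎
    where
    open ≡-Reasoning
    distribute : ∀ x a b c e → a * (x * b) + c * (x * e) ≡ x * (a * b + c * e)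
    distribute = solve-∀
    ∑-T^ : ∀ m → m ≤ k → ∑ m ((T ^ p) w) ≡ ∑ k (λ s → w s * ∑ m ((T ^ p) (δ s)))
    ∑-T^ m m≤k = begin
      ∑ m ((T ^ p) w)                                ≡⟨ ∑-cong-< m (λ x<m → T^-linear p w (<-≤-trans x<m m≤k)) ⟩
      ∑ m (λ x → ∑ k (λ s → w s * (T ^ p) (δ s) x))  ≡⟨ ∑-comm m k _ ⟩
      ∑ k (λ s → ∑ m (λ x → w s * (T ^ p) (δ s) x))  ≡⟨ ∑-cong k (λ s → ∑-*ˡ m (w s) _) ⟩
      ∑ k (λ s → w s * ∑ m ((T ^ p) (δ s)))          ∎

  ∑-T^-δ : ∀ p w → ∑ k (λ s → w s * ∑ k ((T ^ p) (δ s))) ≡ ∑ k ((T ^ p) w)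
  ∑-T^-δ p w = begin
    ∑ k (λ s → w s * ∑ k ((T ^ p) (δ s)))          ≡⟨ ∑-cong k (λ s → ∑-*ˡ k (w s) _) ⟨
    ∑ k (λ s → ∑ k (λ r → w s * (T ^ p) (δ s) r))  ≡⟨ ∑-comm k k _ ⟩
    ∑ k (λ r → ∑ k (λ s → w s * (T ^ p) (δ s) r))  ≡⟨ ∑-cong-< k (λ r<k → T^-linear p w r<k) ⟨
    ∑ k ((T ^ p) w)                                ∎
    where open ≡-Reasoning

  trace≡τ : ∀ n → trace (suc n) ≡ τ (suc n)
  trace≡τ n = begin
    ∑ k (λ s → (T ^ suc n) (δ s) s)
      ≡⟨ ∑-cong k (λ s → T^-expand (suc n) (δ s) s) ⟩
    ∑ k (λ s → (N ^ suc n) (δ s) s + antidiag (suc n) (λ i j → (N ^ i) u s * ∑ k ((T ^ j) (δ s))))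
      ≡⟨ ∑-+ k _ _ ⟩
    ∑ k (λ s → (N ^ suc n) (δ s) s) + ∑ k (λ s → antidiag (suc n) (λ i j → (N ^ i) u s * ∑ k ((T ^ j) (δ s))))
      ≡⟨ cong₂ _+_ (trans (∑-cong k (N^suc-δ-diagonal n)) (∑-zero k))
                   (∑-antidiag k (suc n) (λ s i j → (N ^ i) u s * ∑ k ((T ^ j) (δ s)))) ⟩
    antidiag (suc n) (λ i j → ∑ k (λ s → (N ^ i) u s * ∑ k ((T ^ j) (δ s))))
      ≡⟨ antidiag-cong (suc n) (λ i j → ∑-T^-δ j ((N ^ i) u)) ⟩
    τ (suc n) ∎
    where open ≡-Reasoning

parity : ℕ → ℕ
parity zero          = 0
parity (suc zero)    = 1
parity (suc (suc n)) = parity n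

parity-cases : ∀ n → (parity n ≡ 0 × parity (suc n) ≡ 1) ⊎ (parity n ≡ 1 × parity (suc n) ≡ 0)
parity-cases zero          = inj₁ (refl , refl)
parity-cases (suc zero)    = inj₂ (refl , refl)
parity-cases (suc (suc n)) = parity-cases n

parity≤1 : ∀ n → parity n ≤ 1
parity≤1 n with parity-cases n
... | inj₁ (p≡0 , _) = subst (_≤ 1) (sym p≡0) z≤n
... | inj₂ (p≡1 , _) = subst (_≤ 1) (sym p≡1) ≤-refl

parity-suc*parity : ∀ n → parity (suc n) * parity n ≡ 0
parity-suc*parity n with parity-cases n
... | inj₁ (p≡0 , _)  = trans (cong (parity (suc n) *_) p≡0) (*-zeroʳ (parity (suc n)))
... | inj₂ (_ , ps≡0) = cong (_* parity n) ps≡0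

parity≡0⇒2∣ : ∀ n → parity n ≡ 0 → 2 ∣ n
parity≡0⇒2∣ zero          _  = divides 0 refl
parity≡0⇒2∣ (suc (suc n)) eq with parity≡0⇒2∣ n eq
... | divides q n≡q*2 = divides (suc q) (cong (2 +_) n≡q*2)

parity≡1⇒2∤ : ∀ n → parity n ≡ 1 → ¬ 2 ∣ n
parity≡1⇒2∤ (suc zero)    _  (divides (suc q) ())
parity≡1⇒2∤ (suc (suc n)) eq (divides (suc q) n≡q*2) = parity≡1⇒2∤ n eq (divides q (suc-injective (suc-injective n≡q*2)))

parity+parity-suc : ∀ n → parity n + parity (suc n) ≡ 1
parity+parity-suc zero          = refl
parity+parity-suc (suc zero)    = refl
parity+parity-suc (suc (suc n)) = parity+parity-suc n

∑-parity-reverse : ∀ k → ∑ k (λ r → parity (k ∸ r)) ≡ ⌈ k /2⌉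
∑-parity-reverse zero          = refl
∑-parity-reverse (suc zero)    = refl
∑-parity-reverse (suc (suc k)) = begin
  ∑ (suc (suc k)) (λ r → parity (suc (suc k) ∸ r))
    ≡⟨ ∑-sucˡ (suc k) _ ⟩
  parity k + ∑ (suc k) (λ r → parity (suc k ∸ r))
    ≡⟨ cong (parity k +_) (∑-sucˡ k _) ⟩
  parity k + (parity (suc k) + ∑ k (λ r → parity (k ∸ r)))
    ≡⟨ +-assoc (parity k) _ _ ⟨
  parity k + parity (suc k) + ∑ k (λ r → parity (k ∸ r))
    ≡⟨ cong₂ _+_ (parity+parity-suc k) (∑-parity-reverse k) ⟩
  suc ⌈ k /2⌉ ∎
  where open ≡-Reasoning

/2≡⌊/2⌋ : ∀ n → n / 2 ≡ ⌊ n /2⌋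
/2≡⌊/2⌋ zero          = refl
/2≡⌊/2⌋ (suc zero)    = refl
/2≡⌊/2⌋ (suc (suc n)) = trans (m/n≡1+[m∸n]/n {suc (suc n)} (s≤s (s≤s z≤n))) (cong suc (/2≡⌊/2⌋ n))

[n+1]/2≡⌈n/2⌉ : ∀ n → (n + 1) / 2 ≡ ⌈ n /2⌉
[n+1]/2≡⌈n/2⌉ n = trans (/2≡⌊/2⌋ (n + 1)) (cong ⌊_/2⌋ (+-comm n 1))

[n∸1]/2≡⌈n/2⌉∸1 : ∀ n → (n ∸ 1) / 2 ≡ ⌈ n /2⌉ ∸ 1
[n∸1]/2≡⌈n/2⌉∸1 zero    = refl
[n∸1]/2≡⌈n/2⌉∸1 (suc n) = /2≡⌊/2⌋ n

pascal-≤1 : ∀ n j {b} → b ≤ 1 → n C suc j + b * (n C j) ≡ (n + b) C suc j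
pascal-≤1 n j z≤n = trans (+-identityʳ _) (cong (_C suc j) (sym (+-identityʳ n)))
pascal-≤1 n j (s≤s z≤n) = begin
  n C suc j + (n C j + 0)   ≡⟨ cong (n C suc j +_) (+-identityʳ _) ⟩
  n C suc j + n C j         ≡⟨ +-comm (n C suc j) _ ⟩
  n C j + n C suc j         ≡⟨ nCk+nC[k+1]≡[n+1]C[k+1] n j ⟩
  suc n C suc j             ≡⟨ cong (_C suc j) (+-comm 1 n) ⟩
  (n + 1) C suc j           ∎
  where open ≡-Reasoning

C-absorb : ∀ m n → m * ((m ∸ 1) C n) ≡ suc n * (m C suc n)
C-absorb zero          n       = sym (*-zeroʳ (suc n))
C-absorb (suc a)       zero    = trans (*-identityʳ (suc a)) (sym (trans (+-identityʳ _) (nC1≡n (suc a))))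
C-absorb (suc zero)    (suc m) = sym (*-zeroʳ (suc (suc m)))
C-absorb (suc (suc a)) (suc m) = begin
  suc (suc a) * x
    ≡⟨ split a x ⟩
  suc a * x + x
    ≡⟨ cong (λ z → suc a * z + x) (nCk+nC[k+1]≡[n+1]C[k+1] a m) ⟨
  suc a * (a C m + a C suc m) + x
    ≡⟨ cong (_+ x) (*-distribˡ-+ (suc a) (a C m) (a C suc m)) ⟩
  suc a * (a C m) + suc a * (a C suc m) + x
    ≡⟨ cong (λ z → z + x) (cong₂ _+_ (C-absorb (suc a) m) (C-absorb (suc a) (suc m))) ⟩
  suc m * x + suc (suc m) * y + x
    ≡⟨ collect m x y ⟩
  suc (suc m) * (x + y)
    ≡⟨ cong (suc (suc m) *_) (nCk+nC[k+1]≡[n+1]C[k+1] (suc a) (suc m)) ⟩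
  suc (suc m) * (suc (suc a) C suc (suc m)) ∎
  where
  open ≡-Reasoning
  x = suc a C suc m
  y = suc a C suc (suc m)
  split : ∀ a x → suc (suc a) * x ≡ suc a * x + x
  split = solve-∀
  collect : ∀ m x y → suc m * x + suc (suc m) * y + x ≡ suc (suc m) * (x + y)
  collect = solve-∀

private variable
  A B : Set

∑ₗ : List A → (A → ℕ) → ℕ
∑ₗ []       g = 0
∑ₗ (x ∷ xs) g = g x + ∑ₗ xs g

∑ₗ-zero : ∀ (xs : List A) → ∑ₗ xs (λ _ → 0) ≡ 0
∑ₗ-zero []       = refl
∑ₗ-zero (x ∷ xs) = ∑ₗ-zero xs

∑ₗ-cong : ∀ (xs : List A) {g h : A → ℕ} → g ≗ h → ∑ₗ xs g ≡ ∑ₗ xs h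
∑ₗ-cong []       eq = refl
∑ₗ-cong (x ∷ xs) eq = cong₂ _+_ (eq x) (∑ₗ-cong xs eq)

∑ₗ-++ : ∀ (xs ys : List A) g → ∑ₗ (xs ++ ys) g ≡ ∑ₗ xs g + ∑ₗ ys g
∑ₗ-++ []       ys g = refl
∑ₗ-++ (x ∷ xs) ys g = trans (cong (g x +_) (∑ₗ-++ xs ys g)) (sym (+-assoc (g x) _ _))

∑ₗ-map : ∀ (h : B → A) (xs : List B) g → ∑ₗ (map h xs) g ≡ ∑ₗ xs (g ∘ h)
∑ₗ-map h []       g = refl
∑ₗ-map h (x ∷ xs) g = cong (g (h x) +_) (∑ₗ-map h xs g)

∑ₗ-concatMap : ∀ (h : B → List A) (xs : List B) g →
               ∑ₗ (concatMap h xs) g ≡ ∑ₗ xs (λ x → ∑ₗ (h x) g)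
∑ₗ-concatMap h []       g = refl
∑ₗ-concatMap h (x ∷ xs) g = trans (∑ₗ-++ (h x) (concatMap h xs) g) (cong (∑ₗ (h x) g +_) (∑ₗ-concatMap h xs g))

∑ₗ-+ : ∀ (xs : List A) g h → ∑ₗ xs (λ x → g x + h x) ≡ ∑ₗ xs g + ∑ₗ xs h
∑ₗ-+ []       g h = refl
∑ₗ-+ (x ∷ xs) g h = trans (cong ((g x + h x) +_) (∑ₗ-+ xs g h)) (interchange (g x) (h x) _ _)

∑ₗ-*ˡ : ∀ (xs : List A) c g → ∑ₗ xs (λ x → c * g x) ≡ c * ∑ₗ xs g
∑ₗ-*ˡ []       c g = sym (*-zeroʳ c)
∑ₗ-*ˡ (x ∷ xs) c g = trans (cong (c * g x +_) (∑ₗ-*ˡ xs c g)) (sym (*-distribˡ-+ c _ _))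

∑ₗ-comm : ∀ (xs : List A) (ys : List B) (g : A → B → ℕ) →
          ∑ₗ xs (λ x → ∑ₗ ys (g x)) ≡ ∑ₗ ys (λ y → ∑ₗ xs (λ x → g x y))
∑ₗ-comm []       ys g = sym (∑ₗ-zero ys)
∑ₗ-comm (x ∷ xs) ys g =
  trans (cong (∑ₗ ys (g x) +_) (∑ₗ-comm xs ys g)) (sym (∑ₗ-+ ys (g x) (λ y → ∑ₗ xs (λ x → g x y))))

length-filter≡∑ₗ : ∀ {p} {P : A → Set p} (P? : ∀ x → Dec (P x)) xs →
                   length (filter P? xs) ≡ ∑ₗ xs (λ x → 𝟙 (P? x))
length-filter≡∑ₗ P? []       = refl
length-filter≡∑ₗ P? (x ∷ xs) with P? x
... | yes _ = cong suc (length-filter≡∑ₗ P? xs)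
... | no _  = length-filter≡∑ₗ P? xs

∑ₗ-allFin : ∀ n (g : ℕ → ℕ) → ∑ₗ (allFin n) (g ∘ toℕ) ≡ ∑ n g
∑ₗ-allFin zero    g = refl
∑ₗ-allFin (suc n) g = begin
  g 0 + ∑ₗ (tabulate {n = n} suc) (g ∘ toℕ)     ≡⟨ cong (λ xs → g 0 + ∑ₗ xs (g ∘ toℕ)) (map-tabulate {n = n} id suc) ⟨
  g 0 + ∑ₗ (map suc (allFin n)) (g ∘ toℕ)  ≡⟨ cong (g 0 +_) (∑ₗ-map suc (allFin n) (g ∘ toℕ)) ⟩
  g 0 + ∑ₗ (allFin n) (g ∘ suc ∘ toℕ)      ≡⟨ cong (g 0 +_) (∑ₗ-allFin n (g ∘ suc)) ⟩
  g 0 + ∑ n (g ∘ suc)                      ≡⟨ ∑-sucˡ n g ⟨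
  ∑ (suc n) g                              ∎
  where open ≡-Reasoning

lookup-cnext : ∀ {m} (x : A) (ys : Vec A m) (i : Fin (suc m)) →
               lookup (x ∷ ys) (cnext i) ≡ lookup (ys ∷ʳ x) i
lookup-cnext x []       zero    = refl
lookup-cnext x (y ∷ ys) zero    = refl
lookup-cnext x (y ∷ ys) (suc i) with cnext i | lookup-cnext x ys i
... | zero  | eq = eq
... | suc j | eq = eq

module _ (R : A → A → Set) where

  Chain : ∀ {m} → A → Vec A m → A → Set
  Chain y []       z = R y z
  Chain y (x ∷ w) z = R y x × Chain x w z

  chain? : Decidable R → ∀ {m} y (w : Vec A m) z → Dec (Chain y w z)
  chain? R? y []       z = R? y z
  chain? R? y (x ∷ w) z = R? y x ×-dec chain? R? x w z

  Chain⇔lookup : ∀ {m} y (w : Vec A m) z → Chain y w z ⇔ (∀ i → R (lookup (y ∷ w) i) (lookup (w ∷ʳ z) i))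
  Chain⇔lookup y []      z = mk⇔ (λ { r zero → r }) (λ r → r zero)
  Chain⇔lookup y (x ∷ w) z = mk⇔
    (λ { (r , c) zero → r ; (r , c) (suc i) → Equivalence.to (Chain⇔lookup x w z) c i })
    (λ r → r zero , Equivalence.from (Chain⇔lookup x w z) (r ∘ suc))

-- Larger letters sit at smaller positions, which makes T the transfer matrix of ok? (𝟙-ok).
module TransferMatrix (k : ℕ) where

  isOdd : V
  isOdd r = parity (k ∸ r)

  isEven : V
  isEven r = parity (suc (k ∸ r))

  open RankOneUpdate k isOdd isEven public

  isOdd-suc : ∀ {r} → r < k → isOdd (suc r) ≡ isEven r
  isOdd-suc r<k = cong (λ m → parity (suc m)) (sym (+-∸-assoc 1 r<k))

  odds≤ : ℕ → ℕ
  odds≤ r = ∑ (suc r) isOdd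

  ∑-isEven-C : ∀ j {r} → r ≤ k → ∑ r (λ x → isEven x * (odds≤ x C suc j)) ≡ odds≤ r C suc (suc j)
  ∑-isEven-C j {zero}  _   = sym (k>n⇒nCk≡0 (s≤s (≤-trans (parity≤1 k) (s≤s z≤n))))
  ∑-isEven-C j {suc r} r<k = begin
    ∑ r (λ x → isEven x * (odds≤ x C suc j)) + isEven r * (odds≤ r C suc j)
      ≡⟨ cong (_+ isEven r * (odds≤ r C suc j)) (∑-isEven-C j (<⇒≤ r<k)) ⟩
    odds≤ r C suc (suc j) + isEven r * (odds≤ r C suc j)
      ≡⟨ pascal-≤1 (odds≤ r) (suc j) (parity≤1 (suc (k ∸ r))) ⟩
    (odds≤ r + isEven r) C suc (suc j)
      ≡⟨ cong (λ b → (odds≤ r + b) C suc (suc j)) (isOdd-suc r<k) ⟨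
    odds≤ (suc r) C suc (suc j) ∎
    where open ≡-Reasoning

  N^suc-isOdd : ∀ j {r} → r < k → (N ^ suc j) isOdd r ≡ isEven r * (odds≤ r C suc j)
  N^suc-isOdd zero {r} _ = begin
    isEven r * ∑ r isOdd                        ≡⟨ +-identityʳ _ ⟨
    isEven r * ∑ r isOdd + 0                    ≡⟨ cong (isEven r * ∑ r isOdd +_) (parity-suc*parity (k ∸ r)) ⟨
    isEven r * ∑ r isOdd + isEven r * isOdd r   ≡⟨ *-distribˡ-+ (isEven r) _ _ ⟨
    isEven r * odds≤ r                          ≡⟨ cong (isEven r *_) (nC1≡n (odds≤ r)) ⟨
    isEven r * (odds≤ r C 1)                    ∎
    where open ≡-Reasoning
  N^suc-isOdd (suc j) {r} r<k = cong (isEven r *_) (begin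
    ∑ r ((N ^ suc j) isOdd)                    ≡⟨ ∑-cong-< r (λ x<r → N^suc-isOdd j (<-trans x<r r<k)) ⟩
    ∑ r (λ x → isEven x * (odds≤ x C suc j))   ≡⟨ ∑-isEven-C j (<⇒≤ r<k) ⟩
    odds≤ r C suc (suc j)                      ∎)
    where open ≡-Reasoning

  ∑-isOdd : ∑ k isOdd ≡ ⌈ k /2⌉
  ∑-isOdd = ∑-parity-reverse k

  β≡C : ∀ j → β j ≡ ⌈ k /2⌉ C suc j
  β≡C zero    = trans ∑-isOdd (sym (nC1≡n ⌈ k /2⌉))
  β≡C (suc j) = begin
    ∑ k ((N ^ suc j) isOdd)                    ≡⟨ ∑-cong-< k (N^suc-isOdd j) ⟩
    ∑ k (λ x → isEven x * (odds≤ x C suc j))   ≡⟨ ∑-isEven-C j ≤-refl ⟩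
    odds≤ k C suc (suc j)                      ≡⟨ cong (λ b → (∑ k isOdd + parity b) C suc (suc j)) (n∸n≡0 k) ⟩
    (∑ k isOdd + 0) C suc (suc j)              ≡⟨ cong (_C suc (suc j)) (trans (+-identityʳ (∑ k isOdd)) ∑-isOdd) ⟩
    ⌈ k /2⌉ C suc (suc j)                      ∎
    where open ≡-Reasoning

  τ-convolution : ∀ n → antidiag (suc (suc n)) (λ i j → τ i * (⌈ k /2⌉ C j)) + suc n * (⌈ k /2⌉ C suc n) ≡ τ (suc n) * 2
  τ-convolution n = begin
    antidiag (suc (suc n)) (λ i j → τ i * (⌈ k /2⌉ C j)) + suc n * (⌈ k /2⌉ C suc n)
      ≡⟨ cong (_+ suc n * (⌈ k /2⌉ C suc n)) (antidiag-sucʳ (suc n) (λ i j → τ i * (⌈ k /2⌉ C j))) ⟩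
    τ (suc n) * 1 + antidiag (suc n) (λ i j → τ i * (⌈ k /2⌉ C suc j)) + suc n * (⌈ k /2⌉ C suc n)
      ≡⟨ cong₂ (λ a b → a + b + suc n * (⌈ k /2⌉ C suc n)) (*-identityʳ (τ (suc n))) convolution ⟩
    τ (suc n) + antidiag (suc n) (λ i j → β i * τ j) + suc n * (⌈ k /2⌉ C suc n)
      ≡⟨ +-assoc (τ (suc n)) _ _ ⟩
    τ (suc n) + (antidiag (suc n) (λ i j → β i * τ j) + suc n * (⌈ k /2⌉ C suc n))
      ≡⟨ cong (τ (suc n) +_) (+-comm _ (suc n * (⌈ k /2⌉ C suc n))) ⟩
    τ (suc n) + (suc n * (⌈ k /2⌉ C suc n) + antidiag (suc n) (λ i j → β i * τ j))
      ≡⟨ cong (λ b → τ (suc n) + (suc n * b + antidiag (suc n) (λ i j → β i * τ j))) (β≡C n) ⟨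
    τ (suc n) + (suc n * β n + antidiag (suc n) (λ i j → β i * τ j))
      ≡⟨ cong (τ (suc n) +_) (newton n) ⟨
    τ (suc n) + τ (suc n)
      ≡⟨ cong (τ (suc n) +_) (+-identityʳ (τ (suc n))) ⟨
    τ (suc n) + (τ (suc n) + 0)
      ≡⟨ *-comm 2 (τ (suc n)) ⟩
    τ (suc n) * 2 ∎
    where
    open ≡-Reasoning
    convolution : antidiag (suc n) (λ i j → τ i * (⌈ k /2⌉ C suc j)) ≡ antidiag (suc n) (λ i j → β i * τ j)
    convolution = begin
      antidiag (suc n) (λ i j → τ i * (⌈ k /2⌉ C suc j)) ≡⟨ antidiag-cong (suc n) (λ i j → cong (τ i *_) (β≡C j)) ⟨
      antidiag (suc n) (λ i j → τ i * β j)              ≡⟨ antidiag-comm (suc n) (λ i j → τ i * β j) ⟩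
      antidiag (suc n) (λ i j → τ j * β i)              ≡⟨ antidiag-cong (suc n) (λ i j → *-comm (τ j) (β i)) ⟩
      antidiag (suc n) (λ i j → β i * τ j)              ∎

  position : Fin k → ℕ
  position y = k ∸ letter y

  position<k : ∀ y → position y < k
  position<k y = ∸-monoʳ-< z<s (toℕ<n y)

  isOdd-position : ∀ y → isOdd (position y) ≡ parity (letter y)
  isOdd-position y = cong parity (m∸[m∸n]≡n (toℕ<n y))

  isEven-position : ∀ y → isEven (position y) ≡ parity (suc (letter y))
  isEven-position y = cong (λ m → parity (suc m)) (m∸[m∸n]≡n (toℕ<n y))

  position-< : ∀ y x → letter y < letter x ⇔ position x < position y
  position-< y x = mk⇔ (λ lt → ∸-monoʳ-< lt (toℕ<n x))
                       (λ lt → ≰⇒> (λ lx≤ly → <⇒≱ lt (∸-monoʳ-≤ k lx≤ly)))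

  ∑ₗ-position : ∀ g → ∑ₗ (allFin k) (g ∘ position) ≡ ∑ k g
  ∑ₗ-position g = trans (∑ₗ-allFin k (λ i → g (k ∸ suc i))) (∑-reverse k g)

  Ok : Fin k → Fin k → Set
  Ok y x = 2 ∣ letter y → letter y < letter x

  ok? : Decidable Ok
  ok? y x = (2 ∣? letter y) →-dec (letter y <? letter x)

  𝟙-ok : ∀ y x → 𝟙 (ok? y x) ≡ isOdd (position y) + isEven (position y) * 𝟙 (position x <? position y)
  𝟙-ok y x with parity-cases (letter y)
  ... | inj₁ (p≡0 , ps≡1) = begin
    𝟙 (ok? y x)
      ≡⟨ 𝟙-cong (ok? y x) (position x <? position y)
           (mk⇔ (λ h → Equivalence.to (position-< y x) (h (parity≡0⇒2∣ (letter y) p≡0)))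
                (λ lt _ → Equivalence.from (position-< y x) lt)) ⟩
    𝟙 (position x <? position y)
      ≡⟨ *-identityˡ _ ⟨
    1 * 𝟙 (position x <? position y)
      ≡⟨ cong₂ (λ a b → a + b * 𝟙 (position x <? position y))
               (trans (isOdd-position y) p≡0) (trans (isEven-position y) ps≡1) ⟨
    isOdd (position y) + isEven (position y) * 𝟙 (position x <? position y) ∎
    where open ≡-Reasoning
  ... | inj₂ (p≡1 , ps≡0) = begin
    𝟙 (ok? y x)
      ≡⟨ 𝟙-yes (ok? y x) (λ 2∣l → ⊥-elim (parity≡1⇒2∤ (letter y) p≡1 2∣l)) ⟩
    1
      ≡⟨ cong₂ (λ a b → a + b * 𝟙 (position x <? position y))
               (trans (isOdd-position y) p≡1) (trans (isEven-position y) ps≡0) ⟨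
    isOdd (position y) + isEven (position y) * 𝟙 (position x <? position y) ∎
    where open ≡-Reasoning

  T-row : ∀ v {R} → R < k → ∑ k (λ s → (isOdd R + isEven R * 𝟙 (s <? R)) * v s) ≡ T v R
  T-row v {R} R<k = begin
    ∑ k (λ s → (isOdd R + isEven R * 𝟙 (s <? R)) * v s)
      ≡⟨ ∑-cong k (λ s → distribute (isOdd R) (isEven R) (𝟙 (s <? R)) (v s)) ⟩
    ∑ k (λ s → isOdd R * v s + isEven R * (𝟙 (s <? R) * v s))
      ≡⟨ ∑-+ k _ _ ⟩
    ∑ k (λ s → isOdd R * v s) + ∑ k (λ s → isEven R * (𝟙 (s <? R) * v s))
      ≡⟨ cong₂ _+_ (∑-*ˡ k (isOdd R) v) (∑-*ˡ k (isEven R) _) ⟩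
    isOdd R * ∑ k v + isEven R * ∑ k (λ s → 𝟙 (s <? R) * v s)
      ≡⟨ cong (λ n → isOdd R * ∑ k v + isEven R * ∑ n (λ s → 𝟙 (s <? R) * v s)) (m+[n∸m]≡n (<⇒≤ R<k)) ⟨
    isOdd R * ∑ k v + isEven R * ∑ (R + (k ∸ R)) (λ s → 𝟙 (s <? R) * v s)
      ≡⟨ cong (λ z → isOdd R * ∑ k v + isEven R * z) (∑-restrict R (k ∸ R) v) ⟩
    isOdd R * ∑ k v + isEven R * ∑ R v ∎
    where
    open ≡-Reasoning
    distribute : ∀ a b c x → (a + b * c) * x ≡ a * x + b * (c * x)
    distribute = solve-∀

  ∑ₗ-allWords-suc : ∀ m (g : Vec (Fin k) (suc m) → ℕ) →
                    ∑ₗ (allWords k (suc m)) g ≡ ∑ₗ (allWords k m) (λ w → ∑ₗ (allFin k) (λ x → g (x ∷ w)))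
  ∑ₗ-allWords-suc m g =
    trans (∑ₗ-concatMap (λ w → map (_∷ w) (allFin k)) (allWords k m) g)
          (∑ₗ-cong (allWords k m) (λ w → ∑ₗ-map (_∷ w) (allFin k) g))

  walks : ℕ → Fin k → Fin k → ℕ
  walks m y z = ∑ₗ (allWords k m) (λ w → 𝟙 (chain? Ok ok? y w z))

  walks-suc : ∀ m y z → walks (suc m) y z ≡ ∑ₗ (allFin k) (λ x → 𝟙 (ok? y x) * walks m x z)
  walks-suc m y z = begin
    walks (suc m) y z
      ≡⟨ ∑ₗ-allWords-suc m (λ w → 𝟙 (chain? Ok ok? y w z)) ⟩
    ∑ₗ (allWords k m) (λ w → ∑ₗ (allFin k) (λ x → 𝟙 (ok? y x ×-dec chain? Ok ok? x w z)))
      ≡⟨ ∑ₗ-cong (allWords k m) (λ w → ∑ₗ-cong (allFin k) (λ x → 𝟙-× (ok? y x) (chain? Ok ok? x w z))) ⟩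
    ∑ₗ (allWords k m) (λ w → ∑ₗ (allFin k) (λ x → 𝟙 (ok? y x) * 𝟙 (chain? Ok ok? x w z)))
      ≡⟨ ∑ₗ-comm (allWords k m) (allFin k) _ ⟩
    ∑ₗ (allFin k) (λ x → ∑ₗ (allWords k m) (λ w → 𝟙 (ok? y x) * 𝟙 (chain? Ok ok? x w z)))
      ≡⟨ ∑ₗ-cong (allFin k) (λ x → ∑ₗ-*ˡ (allWords k m) (𝟙 (ok? y x)) _) ⟩
    ∑ₗ (allFin k) (λ x → 𝟙 (ok? y x) * walks m x z) ∎
    where open ≡-Reasoning

  walks≡T^ : ∀ m y z → walks m y z ≡ (T ^ suc m) (δ (position z)) (position y)
  walks≡T^ zero y z = begin
    𝟙 (ok? y z) + 0
      ≡⟨ +-identityʳ _ ⟩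
    𝟙 (ok? y z)
      ≡⟨ 𝟙-ok y z ⟩
    isOdd (position y) + isEven (position y) * 𝟙 (position z <? position y)
      ≡⟨ cong₂ (λ a b → a + isEven (position y) * b) (*-identityʳ _) (∑-δ (position y) (position z)) ⟨
    isOdd (position y) * 1 + isEven (position y) * ∑ (position y) (δ (position z))
      ≡⟨ cong (λ a → isOdd (position y) * a + isEven (position y) * ∑ (position y) (δ (position z)))
              (trans (∑-δ k (position z)) (𝟙-yes (position z <? k) (position<k z))) ⟨
    (T ^ 1) (δ (position z)) (position y) ∎
    where open ≡-Reasoning
  walks≡T^ (suc m) y z = begin
    walks (suc m) y z
      ≡⟨ walks-suc m y z ⟩
    ∑ₗ (allFin k) (λ x → 𝟙 (ok? y x) * walks m x z)
      ≡⟨ ∑ₗ-cong (allFin k) (λ x → cong₂ _*_ (𝟙-ok y x) (walks≡T^ m x z)) ⟩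
    ∑ₗ (allFin k) (λ x → (isOdd (position y) + isEven (position y) * 𝟙 (position x <? position y)) * v (position x))
      ≡⟨ ∑ₗ-position (λ s → (isOdd (position y) + isEven (position y) * 𝟙 (s <? position y)) * v s) ⟩
    ∑ k (λ s → (isOdd (position y) + isEven (position y) * 𝟙 (s <? position y)) * v s)
      ≡⟨ T-row v (position<k y) ⟩
    T v (position y) ∎
    where
    open ≡-Reasoning
    v : V
    v = (T ^ suc m) (δ (position z))

  CyclicEvenUp⇔Chain : ∀ {m} c (v : Vec (Fin k) (suc m)) → CyclicEvenUp (c ∷ v) ⇔ Chain Ok c v c
  CyclicEvenUp⇔Chain c v = mk⇔
    (λ cyc → Equivalence.from (Chain⇔lookup Ok c v c) (λ i → subst (Ok _) (lookup-cnext c v i) (cyc i)))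
    (λ ch i → subst (Ok _) (sym (lookup-cnext c v i)) (Equivalence.to (Chain⇔lookup Ok c v c) ch i))

  f≡trace : ∀ m → f k (suc (suc m)) ≡ trace (suc (suc m))
  f≡trace m = begin
    length (filter cyclicEvenUp? (allWords k (suc (suc m))))
      ≡⟨ length-filter≡∑ₗ cyclicEvenUp? (allWords k (suc (suc m))) ⟩
    ∑ₗ (allWords k (suc (suc m))) (λ w → 𝟙 (cyclicEvenUp? w))
      ≡⟨ ∑ₗ-allWords-suc (suc m) (λ w → 𝟙 (cyclicEvenUp? w)) ⟩
    ∑ₗ (allWords k (suc m)) (λ v → ∑ₗ (allFin k) (λ c → 𝟙 (cyclicEvenUp? (c ∷ v))))
      ≡⟨ ∑ₗ-cong (allWords k (suc m)) (λ v → ∑ₗ-cong (allFin k) (λ c →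
           𝟙-cong (cyclicEvenUp? (c ∷ v)) (chain? Ok ok? c v c) (CyclicEvenUp⇔Chain c v))) ⟩
    ∑ₗ (allWords k (suc m)) (λ v → ∑ₗ (allFin k) (λ c → 𝟙 (chain? Ok ok? c v c)))
      ≡⟨ ∑ₗ-comm (allWords k (suc m)) (allFin k) _ ⟩
    ∑ₗ (allFin k) (λ c → walks (suc m) c c)
      ≡⟨ ∑ₗ-cong (allFin k) (λ c → walks≡T^ (suc m) c c) ⟩
    ∑ₗ (allFin k) (λ c → (T ^ suc (suc m)) (δ (position c)) (position c))
      ≡⟨ ∑ₗ-position (λ s → (T ^ suc (suc m)) (δ s) s) ⟩
    trace (suc (suc m)) ∎
    where open ≡-Reasoning

f-one : ∀ k → f k 1 ≡ k
f-one k = begin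
  length (filter cyclicEvenUp? (allWords k 1))  ≡⟨ cong length (filter-all cyclicEvenUp? (universal (λ _ → tt) (allWords k 1))) ⟩
  length (map (_∷ []) (allFin k) ++ [])         ≡⟨ cong length (++-identityʳ (map (_∷ []) (allFin k))) ⟩
  length (map (_∷ []) (allFin k))               ≡⟨ length-map (_∷ []) (allFin k) ⟩
  length (allFin k)                             ≡⟨ length-tabulate id ⟩
  k                                             ∎
  where open ≡-Reasoning

-- Opened only from here on: the constructor +_ makes ℕ sections such as (x +_) ambiguous.
open import Data.Integer using (+_)

map-applyUpTo : ∀ (g : A → B) (h : ℕ → A) n → map g (applyUpTo h n) ≡ applyUpTo (g ∘ h) n
map-applyUpTo g h zero    = refl
map-applyUpTo g h (suc n) = cong (g (h 0) ∷_) (map-applyUpTo g (h ∘ suc) n)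

shift : Series → Series
shift S i = S (suc i)

⊛-at-0 : ∀ S U → (S ⊛ U) 0 ≡ S 0 ℤ.* U 0
⊛-at-0 S U = ℤ.+-identityʳ _

⊛-at-suc : ∀ S U n → (S ⊛ U) (suc n) ≡ S 0 ℤ.* U (suc n) ℤ.+ (shift S ⊛ U) n
⊛-at-suc S U n =
  trans (cong (foldr ℤ._+_ (+ 0)) (map-applyUpTo (λ i → S i ℤ.* U (suc n ∸ i)) id (suc (suc n))))
        (cong (ℤ._+_ (S 0 ℤ.* U (suc n)))
              (sym (cong (foldr ℤ._+_ (+ 0)) (map-applyUpTo (λ i → S (suc i) ℤ.* U (n ∸ i)) id (suc n)))))

⊛-congˡ : ∀ {S S′} U → S ≗ S′ → S ⊛ U ≗ S′ ⊛ U
⊛-congˡ U S≗S′ n = cong (foldr ℤ._+_ (+ 0)) (map-cong (λ i → cong (ℤ._* U (n ∸ i)) (S≗S′ i)) (upTo (suc n)))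

⊛-congʳ : ∀ S {U U′} → U ≗ U′ → S ⊛ U ≗ S ⊛ U′
⊛-congʳ S U≗U′ n = cong (foldr ℤ._+_ (+ 0)) (map-cong (λ i → cong (S i ℤ.*_) (U≗U′ (n ∸ i))) (upTo (suc n)))

⊛-distribʳ-⊕ : ∀ S S′ U n → ((S ⊕ S′) ⊛ U) n ≡ (S ⊛ U) n ℤ.+ (S′ ⊛ U) n
⊛-distribʳ-⊕ S S′ U zero = begin
  ((S ⊕ S′) ⊛ U) 0                    ≡⟨ ⊛-at-0 (S ⊕ S′) U ⟩
  (S 0 ℤ.+ S′ 0) ℤ.* U 0              ≡⟨ ℤ.*-distribʳ-+ (U 0) (S 0) (S′ 0) ⟩
  S 0 ℤ.* U 0 ℤ.+ S′ 0 ℤ.* U 0        ≡⟨ cong₂ ℤ._+_ (⊛-at-0 S U) (⊛-at-0 S′ U) ⟨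
  (S ⊛ U) 0 ℤ.+ (S′ ⊛ U) 0            ∎
  where open ≡-Reasoning
⊛-distribʳ-⊕ S S′ U (suc n) = begin
  ((S ⊕ S′) ⊛ U) (suc n)
    ≡⟨ ⊛-at-suc (S ⊕ S′) U n ⟩
  (S 0 ℤ.+ S′ 0) ℤ.* U (suc n) ℤ.+ ((shift S ⊕ shift S′) ⊛ U) n
    ≡⟨ cong₂ ℤ._+_ (ℤ.*-distribʳ-+ (U (suc n)) (S 0) (S′ 0)) (⊛-distribʳ-⊕ (shift S) (shift S′) U n) ⟩
  (S 0 ℤ.* U (suc n) ℤ.+ S′ 0 ℤ.* U (suc n)) ℤ.+ ((shift S ⊛ U) n ℤ.+ (shift S′ ⊛ U) n)
    ≡⟨ ℤ-interchange (S 0 ℤ.* U (suc n)) (S′ 0 ℤ.* U (suc n)) _ _ ⟩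
  (S 0 ℤ.* U (suc n) ℤ.+ (shift S ⊛ U) n) ℤ.+ (S′ 0 ℤ.* U (suc n) ℤ.+ (shift S′ ⊛ U) n)
    ≡⟨ cong₂ ℤ._+_ (⊛-at-suc S U n) (⊛-at-suc S′ U n) ⟨
  (S ⊛ U) (suc n) ℤ.+ (S′ ⊛ U) (suc n) ∎
  where open ≡-Reasoning

⊛-distribˡ-⊖ : ∀ S U U′ n → (S ⊛ (U ⊖ U′)) n ≡ (S ⊛ U) n ℤ.- (S ⊛ U′) n
⊛-distribˡ-⊖ S U U′ zero = begin
  (S ⊛ (U ⊖ U′)) 0                    ≡⟨ ⊛-at-0 S (U ⊖ U′) ⟩
  S 0 ℤ.* (U 0 ℤ.- U′ 0)              ≡⟨ distrib-- (S 0) (U 0) (U′ 0) ⟩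
  S 0 ℤ.* U 0 ℤ.- S 0 ℤ.* U′ 0        ≡⟨ cong₂ ℤ._-_ (⊛-at-0 S U) (⊛-at-0 S U′) ⟨
  (S ⊛ U) 0 ℤ.- (S ⊛ U′) 0            ∎
  where
  open ≡-Reasoning
  distrib-- : ∀ a b c → a ℤ.* (b ℤ.- c) ≡ a ℤ.* b ℤ.- a ℤ.* c
  distrib-- = ℤ-Solver.solve-∀
⊛-distribˡ-⊖ S U U′ (suc n) = begin
  (S ⊛ (U ⊖ U′)) (suc n)
    ≡⟨ ⊛-at-suc S (U ⊖ U′) n ⟩
  S 0 ℤ.* (U (suc n) ℤ.- U′ (suc n)) ℤ.+ (shift S ⊛ (U ⊖ U′)) n
    ≡⟨ cong (ℤ._+_ (S 0 ℤ.* (U (suc n) ℤ.- U′ (suc n)))) (⊛-distribˡ-⊖ (shift S) U U′ n) ⟩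
  S 0 ℤ.* (U (suc n) ℤ.- U′ (suc n)) ℤ.+ ((shift S ⊛ U) n ℤ.- (shift S ⊛ U′) n)
    ≡⟨ rearrange (S 0) (U (suc n)) (U′ (suc n)) _ _ ⟩
  (S 0 ℤ.* U (suc n) ℤ.+ (shift S ⊛ U) n) ℤ.- (S 0 ℤ.* U′ (suc n) ℤ.+ (shift S ⊛ U′) n)
    ≡⟨ cong₂ ℤ._-_ (⊛-at-suc S U n) (⊛-at-suc S U′ n) ⟨
  (S ⊛ U) (suc n) ℤ.- (S ⊛ U′) (suc n) ∎
  where
  open ≡-Reasoning
  rearrange : ∀ a b c x y → a ℤ.* (b ℤ.- c) ℤ.+ (x ℤ.- y) ≡ (a ℤ.* b ℤ.+ x) ℤ.- (a ℤ.* c ℤ.+ y)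
  rearrange = ℤ-Solver.solve-∀

⊛-zeroˡ : ∀ U n → ((λ _ → + 0) ⊛ U) n ≡ + 0
⊛-zeroˡ U zero    = refl
⊛-zeroˡ U (suc n) = trans (⊛-at-suc (λ _ → + 0) U n) (trans (ℤ.+-identityˡ _) (⊛-zeroˡ U n))

⊛-constˡ : ∀ c U n → (const c ⊛ U) n ≡ c ℤ.* U n
⊛-constˡ c U zero    = ⊛-at-0 (const c) U
⊛-constˡ c U (suc n) = begin
  (const c ⊛ U) (suc n)                               ≡⟨ ⊛-at-suc (const c) U n ⟩
  c ℤ.* U (suc n) ℤ.+ ((λ _ → + 0) ⊛ U) n             ≡⟨ cong (ℤ._+_ (c ℤ.* U (suc n))) (⊛-zeroˡ U n) ⟩
  c ℤ.* U (suc n) ℤ.+ + 0                             ≡⟨ ℤ.+-identityʳ _ ⟩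
  c ℤ.* U (suc n)                                     ∎
  where open ≡-Reasoning

⊛-constʳ : ∀ S c n → (S ⊛ const c) n ≡ S n ℤ.* c
⊛-constʳ S c zero    = ⊛-at-0 S (const c)
⊛-constʳ S c (suc n) = begin
  (S ⊛ const c) (suc n)                               ≡⟨ ⊛-at-suc S (const c) n ⟩
  S 0 ℤ.* + 0 ℤ.+ (shift S ⊛ const c) n               ≡⟨ cong₂ ℤ._+_ (ℤ.*-zeroʳ (S 0)) (⊛-constʳ (shift S) c n) ⟩
  + 0 ℤ.+ S (suc n) ℤ.* c                             ≡⟨ ℤ.+-identityˡ _ ⟩
  S (suc n) ℤ.* c                                     ∎
  where open ≡-Reasoning

⊛-ℕ : ∀ (g h : ℕ → ℕ) n → ((+_ ∘ g) ⊛ (+_ ∘ h)) n ≡ + antidiag (suc n) (λ i j → g i * h j)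
⊛-ℕ g h zero    = trans (⊛-at-0 (+_ ∘ g) (+_ ∘ h)) (trans (sym (ℤ.pos-* (g 0) (h 0))) (cong +_ (sym (+-identityʳ _))))
⊛-ℕ g h (suc n) = trans (⊛-at-suc (+_ ∘ g) (+_ ∘ h) n)
                        (cong₂ ℤ._+_ (sym (ℤ.pos-* (g 0) (h (suc n)))) (⊛-ℕ (g ∘ suc) h n))

shift-X : shift X ≗ const (+ 1)
shift-X zero    = refl
shift-X (suc i) = refl

const⊛X⊛-at-0 : ∀ c U → ((const c ⊛ X) ⊛ U) 0 ≡ + 0
const⊛X⊛-at-0 c U = begin
  ((const c ⊛ X) ⊛ U) 0               ≡⟨ ⊛-at-0 (const c ⊛ X) U ⟩
  (const c ⊛ X) 0 ℤ.* U 0             ≡⟨ cong (ℤ._* U 0) (trans (⊛-constˡ c X 0) (ℤ.*-zeroʳ c)) ⟩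
  + 0 ℤ.* U 0                         ≡⟨⟩
  + 0                                 ∎
  where open ≡-Reasoning

const⊛X⊛-at-suc : ∀ c U n → ((const c ⊛ X) ⊛ U) (suc n) ≡ c ℤ.* U n
const⊛X⊛-at-suc c U n = begin
  ((const c ⊛ X) ⊛ U) (suc n)
    ≡⟨ ⊛-at-suc (const c ⊛ X) U n ⟩
  (const c ⊛ X) 0 ℤ.* U (suc n) ℤ.+ (shift (const c ⊛ X) ⊛ U) n
    ≡⟨ cong₂ ℤ._+_ (cong (ℤ._* U (suc n)) (trans (⊛-constˡ c X 0) (ℤ.*-zeroʳ c))) (⊛-congˡ U shift-cX n) ⟩
  + 0 ℤ.+ (const c ⊛ U) n
    ≡⟨ ℤ.+-identityˡ _ ⟩
  (const c ⊛ U) n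
    ≡⟨ ⊛-constˡ c U n ⟩
  c ℤ.* U n ∎
  where
  open ≡-Reasoning
  shift-cX : shift (const c ⊛ X) ≗ const c
  shift-cX i = trans (⊛-constˡ c X (suc i)) (trans (cong (c ℤ.*_) (shift-X i)) (c*const1≡const i))
    where
    c*const1≡const : ∀ i → c ℤ.* const (+ 1) i ≡ const c i
    c*const1≡const zero    = ℤ.*-identityʳ c
    c*const1≡const (suc i) = ℤ.*-zeroʳ c

[1+X]^-coeff : ∀ m j → ((const (+ 1) ⊕ X) ^ₛ m) j ≡ + (m C j)
[1+X]^-coeff zero    zero    = refl
[1+X]^-coeff zero    (suc j) = refl
[1+X]^-coeff (suc m) zero    = trans (⊛-at-0 O (O ^ₛ m)) (trans (ℤ.*-identityˡ _) ([1+X]^-coeff m 0))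
  where O = const (+ 1) ⊕ X
[1+X]^-coeff (suc m) (suc j) = begin
  (O ⊛ (O ^ₛ m)) (suc j)
    ≡⟨ ⊛-at-suc O (O ^ₛ m) j ⟩
  + 1 ℤ.* (O ^ₛ m) (suc j) ℤ.+ (shift O ⊛ (O ^ₛ m)) j
    ≡⟨ cong₂ ℤ._+_ (ℤ.*-identityˡ ((O ^ₛ m) (suc j)))
                   (trans (⊛-congˡ (O ^ₛ m) shift-O j) (trans (⊛-constˡ (+ 1) (O ^ₛ m) j) (ℤ.*-identityˡ ((O ^ₛ m) j)))) ⟩
  (O ^ₛ m) (suc j) ℤ.+ (O ^ₛ m) j
    ≡⟨ cong₂ ℤ._+_ ([1+X]^-coeff m (suc j)) ([1+X]^-coeff m j) ⟩
  + (m C suc j + m C j)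
    ≡⟨ cong +_ (trans (+-comm (m C suc j) (m C j)) (nCk+nC[k+1]≡[n+1]C[k+1] m j)) ⟩
  + (suc m C suc j) ∎
  where
  open ≡-Reasoning
  O = const (+ 1) ⊕ X
  shift-O : shift O ≗ const (+ 1)
  shift-O zero    = refl
  shift-O (suc i) = refl

module _ (k : ℕ) where

  open TransferMatrix k

  τₛ : Series
  τₛ n = + τ n

  linearPart : Series
  linearPart = const (+ 1) ⊕ X ⊛ const (+ ⌊ k /2⌋)

  denominator : Series
  denominator = (const (+ 1) ⊕ X) ^ₛ ⌈ k /2⌉ ⊖ const (+ 2)

  numerator : Series
  numerator = const (+ ⌈ k /2⌉) ⊛ X ⊛ (const (+ 1) ⊕ X) ^ₛ (⌈ k /2⌉ ∸ 1)

  F≗linearPart⊕τₛ : F k ≗ linearPart ⊕ τₛ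
  F≗linearPart⊕τₛ zero          = refl
  F≗linearPart⊕τₛ (suc zero)    = begin
    + f k 1
      ≡⟨ cong +_ (f-one k) ⟩
    + k
      ≡⟨ cong +_ (⌊n/2⌋+⌈n/2⌉≡n k) ⟨
    + (⌊ k /2⌋ + ⌈ k /2⌉)
      ≡⟨ cong (λ a → + (⌊ k /2⌋ + a)) (trans (+-identityʳ _) ∑-isOdd) ⟨
    + ⌊ k /2⌋ ℤ.+ + τ 1
      ≡⟨ cong (ℤ._+ + τ 1) (trans (ℤ.+-identityˡ _) (trans (⊛-constʳ X (+ ⌊ k /2⌋) 1) (ℤ.*-identityˡ _))) ⟨
    + 0 ℤ.+ (X ⊛ const (+ ⌊ k /2⌋)) 1 ℤ.+ + τ 1 ∎
    where open ≡-Reasoning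
  F≗linearPart⊕τₛ (suc (suc m)) = begin
    + f k (suc (suc m))
      ≡⟨ cong +_ (trans (f≡trace m) (trace≡τ (suc m))) ⟩
    + τ (suc (suc m))
      ≡⟨⟩
    + 0 ℤ.+ X (suc (suc m)) ℤ.* + ⌊ k /2⌋ ℤ.+ + τ (suc (suc m))
      ≡⟨ cong (λ a → + 0 ℤ.+ a ℤ.+ + τ (suc (suc m))) (⊛-constʳ X (+ ⌊ k /2⌋) (suc (suc m))) ⟨
    + 0 ℤ.+ (X ⊛ const (+ ⌊ k /2⌋)) (suc (suc m)) ℤ.+ + τ (suc (suc m)) ∎
    where open ≡-Reasoning

  τₛ⊛denominator≡-numerator : ∀ n → (τₛ ⊛ denominator) n ≡ ℤ.- numerator n
  τₛ⊛denominator≡-numerator n = begin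
    (τₛ ⊛ (P ⊖ const (+ 2))) n
      ≡⟨ ⊛-distribˡ-⊖ τₛ P (const (+ 2)) n ⟩
    (τₛ ⊛ P) n ℤ.- (τₛ ⊛ const (+ 2)) n
      ≡⟨ cong₂ ℤ._-_ (trans (⊛-congʳ τₛ ([1+X]^-coeff ⌈ k /2⌉) n) (⊛-ℕ τ (⌈ k /2⌉ C_) n))
                     (trans (⊛-constʳ τₛ (+ 2) n) (sym (ℤ.pos-* (τ n) 2))) ⟩
    + antidiag (suc n) (λ i j → τ i * (⌈ k /2⌉ C j)) ℤ.- + (τ n * 2)
      ≡⟨ coefficient n ⟩
    ℤ.- numerator n ∎
    where
    open ≡-Reasoning
    P  = (const (+ 1) ⊕ X) ^ₛ ⌈ k /2⌉
    P′ = (const (+ 1) ⊕ X) ^ₛ (⌈ k /2⌉ ∸ 1)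
    cancel : ∀ a b → a ℤ.- (a ℤ.+ b) ≡ ℤ.- b
    cancel = ℤ-Solver.solve-∀
    coefficient : ∀ n → + antidiag (suc n) (λ i j → τ i * (⌈ k /2⌉ C j)) ℤ.- + (τ n * 2) ≡ ℤ.- numerator n
    coefficient zero    = sym (cong ℤ.-_ (const⊛X⊛-at-0 (+ ⌈ k /2⌉) P′))
    coefficient (suc n) = begin
      + D ℤ.- + (τ (suc n) * 2)
        ≡⟨ cong (λ a → + D ℤ.- + a) (τ-convolution n) ⟨
      + D ℤ.- (+ D ℤ.+ + (suc n * (⌈ k /2⌉ C suc n)))
        ≡⟨ cancel (+ D) _ ⟩
      ℤ.- + (suc n * (⌈ k /2⌉ C suc n))
        ≡⟨ cong (λ a → ℤ.- + a) (C-absorb ⌈ k /2⌉ n) ⟨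
      ℤ.- + (⌈ k /2⌉ * ((⌈ k /2⌉ ∸ 1) C n))
        ≡⟨ cong ℤ.-_ (ℤ.pos-* ⌈ k /2⌉ _) ⟩
      ℤ.- (+ ⌈ k /2⌉ ℤ.* + ((⌈ k /2⌉ ∸ 1) C n))
        ≡⟨ cong (λ a → ℤ.- (+ ⌈ k /2⌉ ℤ.* a)) ([1+X]^-coeff (⌈ k /2⌉ ∸ 1) n) ⟨
      ℤ.- (+ ⌈ k /2⌉ ℤ.* P′ n)
        ≡⟨ cong ℤ.-_ (const⊛X⊛-at-suc (+ ⌈ k /2⌉) P′ n) ⟨
      ℤ.- numerator (suc n) ∎
      where
      D = antidiag (suc (suc n)) (λ i j → τ i * (⌈ k /2⌉ C j))

theorem3 : (k : ℕ) → 2 ≤ k → (n : ℕ) →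
    (F k ⊛ ((const (+ 1) ⊕ X) ^ₛ ((k + 1) / 2) ⊖ const (+ 2))) n
      ≡ ((const (+ 1) ⊕ X ⊛ const (+ (k / 2))) ⊛ ((const (+ 1) ⊕ X) ^ₛ ((k + 1) / 2) ⊖ const (+ 2))
         ⊖ const (+ ((k + 1) / 2)) ⊛ X ⊛ (const (+ 1) ⊕ X) ^ₛ ((k ∸ 1) / 2)) n
-- The identity holds for every k.
theorem3 k _ n rewrite [n+1]/2≡⌈n/2⌉ k | /2≡⌊/2⌋ k | [n∸1]/2≡⌈n/2⌉∸1 k = begin
  (F k ⊛ Q) n                 ≡⟨ ⊛-congˡ Q (F≗linearPart⊕τₛ k) n ⟩
  ((E ⊕ τₛ k) ⊛ Q) n          ≡⟨ ⊛-distribʳ-⊕ E (τₛ k) Q n ⟩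
  (E ⊛ Q) n ℤ.+ (τₛ k ⊛ Q) n  ≡⟨ cong (ℤ._+_ ((E ⊛ Q) n)) (τₛ⊛denominator≡-numerator k n) ⟩
  (E ⊛ Q ⊖ numerator k) n     ∎
  where
  open ≡-Reasoning
  E = linearPart k
  Q = denominator k
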